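{- For integers $m\geq 3$ and $1\leq s\leq \lfloor (m-1)/2\rfloor$, $\mbox{min-seed}(P(m,s),2)=\lceil (m+1)/2\rceil$.
   Context: The generalized Petersen graph $P(m,s)$ has vertex set $\{v_1,\dots,v_m,u_1,\dots,u_m\}$ and edge set $\{v_iv_{i+1},\,u_iv_i,\,u_iu_{i+s}: i=1,\dots,m\}$, subscripts modulo $m$. For a graph $G$ and positive integer $k$, the activation process in $(G,k)$ starting at $S\subseteq V(G)$: at time $0$ exactly the vertices of $S$ are active; at each subsequent step every inactive vertex with at least $k$ active neighbors becomes active; active vertices stay active; the process stops when nothing changes. $\mbox{min-seed}(G,k)$ is the minimum size of a set $S\subseteq V(G)$ such that at the end of this process all vertices of $G$ are active. -}

module Defs where

open import Data.Nat using (ℕ; zero; suc; _+_; _≤_; _≤ᵇ_; _≡ᵇ_; _%_)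
open import Data.Bool using (Bool; true; false; _∨_; _∧_; if_then_else_)
open import Data.Fin using (Fin; toℕ; splitAt)
open import Data.Fin.Subset using (Subset; ∣_∣)
open import Data.Vec using (lookup; tabulate)
open import Data.List using (List; filterᵇ; length; allFin)
open import Data.Sum using (_⊎_; inj₁; inj₂)
open import Data.Product using (Σ; _×_; ∃-syntax)
open import Relation.Binary.PropositionalEquality using (_≡_)

record Graph : Set where
  field
    order : ℕ
    adj   : Fin order → Fin order → Bool
open Graph public

jump : ℕ → ℕ → ℕ → ℕ → Bool
jump zero    d i j = false
jump (suc m) d i j = ((i + d) % suc m ≡ᵇ j) ∨ ((j + d) % suc m ≡ᵇ i)

-- Generalized Petersen graph P(m,s) on Fin (m + m):
-- index i < m is v_i (outer), index m + i is u_i (inner), i ∈ {0,…,m-1}.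
-- Edges: v_i v_{i+1}, u_i v_i, u_i u_{i+s} (indices mod m).
petersenAdj : (m s : ℕ) → Fin (m + m) → Fin (m + m) → Bool
petersenAdj m s x y with splitAt m x | splitAt m y
... | inj₁ i | inj₁ j = jump m 1 (toℕ i) (toℕ j)
... | inj₂ i | inj₂ j = jump m s (toℕ i) (toℕ j)
... | inj₁ i | inj₂ j = toℕ i ≡ᵇ toℕ j
... | inj₂ i | inj₁ j = toℕ i ≡ᵇ toℕ j

P : ℕ → ℕ → Graph
P m s = record { order = m + m ; adj = petersenAdj m s }

activeNbrs : (G : Graph) → (Fin (order G) → Bool) → Fin (order G) → ℕ
activeNbrs G A x = length (filterᵇ (λ y → adj G x y ∧ A y) (allFin (order G)))

active : (G : Graph) (k : ℕ) → Subset (order G) → ℕ → Fin (order G) → Bool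
active G k S zero    x = lookup S x
active G k S (suc t) x = active G k S t x ∨ (k ≤ᵇ activeNbrs G (active G k S t) x)

Percolates : (G : Graph) (k : ℕ) → Subset (order G) → Set
Percolates G k S = ∃[ t ] (∀ x → active G k S t x ≡ true)

MinSeed≡ : (G : Graph) (k c : ℕ) → Set
MinSeed≡ G k c =
  (∃[ S ] (∣ S ∣ ≡ c × Percolates G k S)) ×
  (∀ (S : Subset (order G)) → Percolates G k S → c ≤ ∣ S ∣)

module Submission where

-- Both bounds are instances of general facts about the activation process with
-- threshold 2.  Lower bound: in a graph of maximum degree 3 on n ≥ 1 vertices
-- every percolating set S has n + 1 ≤ 4|S|.  Each edge carries two units of
-- weight, handed to its later-activated endpoint (split on ties); every
-- non-seed, being activated by two earlier neighbours, receives at least 4,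
-- and the last activated vertex receives one unit from each of its edges.
-- Summing against the degrees gives 4N + 1 ≤ 3n for the N non-seeds.  For
-- P(m,s), which is cubic, n = 2m and this is |S| ≥ ⌈(m+1)/2⌉.  Upper bound: a
-- set percolates as soon as there is a bounded rank function under which every
-- non-seed has two distinct neighbours of smaller rank.  Writing m = a + 2s
-- with a ≥ 1, an explicit seed set of size ⌈(m+1)/2⌉ is given together with
-- such a rank function.

open import Defs
open import Data.Nat using (ℕ; zero; suc; NonZero; _+_; _*_; _∸_; _≤_; _<_; z≤n; s≤s; ⌊_/2⌋; ⌈_/2⌉; _≤ᵇ_; _<ᵇ_; _≡ᵇ_; _%_)
open import Data.Nat.Properties
open import Data.Nat.DivMod using (m<n⇒m%n≡m; [m+n]%n≡m%n; %-distribˡ-+)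
open import Data.Nat.Tactic.RingSolver using (solve-∀)
open import Data.Bool using (Bool; true; false; _∨_; _∧_; not; if_then_else_)
open import Data.Bool.Properties as Boolₚ using (T-≡; ∨-zeroʳ)
open import Data.Fin as Fin using (Fin; toℕ; splitAt; _↑ˡ_; _↑ʳ_)
import Data.Fin.Properties as Finₚ
open import Data.Fin.Subset using (Subset; ∣_∣)
open import Data.Vec using (lookup; tabulate; _∷_; [])
open import Data.Vec.Properties using (lookup∘tabulate)
open import Data.List using (length; filterᵇ; allFin)
import Data.List as List
import Data.List.Relation.Unary.All as All
open import Data.List.Membership.Propositional.Properties using (∈-allFin)
open import Data.List.Extrema.Nat using (argmax; f[xs]≤f[argmax])
open import Data.Sum using (inj₁; inj₂; [_,_]′)
open import Data.Product using (_×_; _,_; ∃-syntax)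
open import Relation.Nullary using (yes; no; does; ¬_; contradiction)
open import Relation.Binary.PropositionalEquality
open import Function using (Equivalence)
open import Algebra.Properties.CommutativeMonoid.Sum +-0-commutativeMonoid
  using (sum; sum-syntax; sum-cong-≗; ∑-distrib-+; ∑-comm; sum-init-last)

≡ᵇ-true : ∀ a b → (a ≡ᵇ b) ≡ true → a ≡ b
≡ᵇ-true a b a≡ᵇb = ≡ᵇ⇒≡ a b (Equivalence.from T-≡ a≡ᵇb)

≡ᵇ-refl : ∀ a → (a ≡ᵇ a) ≡ true
≡ᵇ-refl a = Equivalence.to T-≡ (≡⇒≡ᵇ a a refl)

≡ᵇ-false : ∀ {a b} → (a ≡ᵇ b) ≡ false → a ≢ b
≡ᵇ-false {a} a≢ᵇa refl with trans (sym (≡ᵇ-refl a)) a≢ᵇa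
... | ()

≡ᵇ-sym : ∀ a b → (a ≡ᵇ b) ≡ (b ≡ᵇ a)
≡ᵇ-sym zero    zero    = refl
≡ᵇ-sym zero    (suc b) = refl
≡ᵇ-sym (suc a) zero    = refl
≡ᵇ-sym (suc a) (suc b) = ≡ᵇ-sym a b

<ᵇ-true : ∀ {k c} → k < c → (k <ᵇ c) ≡ true
<ᵇ-true k<c = Equivalence.to T-≡ (<⇒<ᵇ k<c)

<ᵇ-false : ∀ {k c} → c ≤ k → (k <ᵇ c) ≡ false
<ᵇ-false {k} {c} c≤k = Boolₚ.¬-not (λ k<ᵇc → <⇒≱ (<ᵇ⇒< k c (Equivalence.from T-≡ k<ᵇc)) c≤k)

≤ᵇ-true : ∀ {k c} → k ≤ c → (k ≤ᵇ c) ≡ true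
≤ᵇ-true k≤c = Equivalence.to T-≡ (≤⇒≤ᵇ k≤c)

≤ᵇ-false : ∀ {k c} → c < k → (k ≤ᵇ c) ≡ false
≤ᵇ-false {k} {c} c<k = Boolₚ.¬-not (λ k≤ᵇc → <⇒≱ c<k (≤ᵇ⇒≤ k c (Equivalence.from T-≡ k≤ᵇc)))

even : ℕ → Bool
even zero          = true
even (suc zero)    = false
even (suc (suc k)) = even k

even-pred : ∀ k → even (suc k) ≡ false → even k ≡ true
even-pred zero          _   = refl
even-pred (suc (suc k)) odd = even-pred k odd

n≢2+n : ∀ n → n ≢ suc (suc n)
n≢2+n (suc n) eq = n≢2+n n (suc-injective eq)

half-+ : ∀ k n → ⌊ (k + k) + n /2⌋ ≡ k + ⌊ n /2⌋
half-+ zero    n = refl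
half-+ (suc k) n rewrite +-suc k k = cong suc (half-+ k n)

translate-injective : ∀ M .{{_ : NonZero M}} {a b} d → a < M → b < M → d ≤ M →
                      (a + d) % M ≡ (b + d) % M → a ≡ b
translate-injective M {a} {b} d a<M b<M d≤M same =
  trans (undo a a<M) (trans (cong (λ r → (r + (M ∸ d) % M) % M) same) (sym (undo b b<M)))
  where
  undo : ∀ a → a < M → a ≡ ((a + d) % M + (M ∸ d) % M) % M
  undo a a<M = begin
    a                              ≡⟨ sym (m<n⇒m%n≡m a<M) ⟩
    a % M                          ≡⟨ sym ([m+n]%n≡m%n a M) ⟩
    (a + M) % M                    ≡⟨ cong (λ c → (a + c) % M) (sym (m+[n∸m]≡n d≤M)) ⟩
    (a + (d + (M ∸ d))) % M        ≡⟨ cong (_% M) (sym (+-assoc a d (M ∸ d))) ⟩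
    (a + d + (M ∸ d)) % M          ≡⟨ %-distribˡ-+ (a + d) (M ∸ d) M ⟩
    ((a + d) % M + (M ∸ d) % M) % M ∎
    where open ≡-Reasoning

𝟙 : Bool → ℕ
𝟙 true  = 1
𝟙 false = 0

sum-mono : ∀ {n} {f g : Fin n → ℕ} → (∀ i → f i ≤ g i) → sum f ≤ sum g
sum-mono {zero}  f≤g = z≤n
sum-mono {suc n} f≤g = +-mono-≤ (f≤g Fin.zero) (sum-mono (λ i → f≤g (Fin.suc i)))

sum-zero : ∀ {n} {f : Fin n → ℕ} → (∀ i → f i ≡ 0) → sum f ≡ 0
sum-zero {zero}  f≡0 = refl
sum-zero {suc n} f≡0 rewrite f≡0 Fin.zero = sum-zero (λ i → f≡0 (Fin.suc i))

sum-*ˡ : ∀ {n} c (f : Fin n → ℕ) → ∑[ i < n ] (c * f i) ≡ c * sum f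
sum-*ˡ {zero}  c f = sym (*-zeroʳ c)
sum-*ˡ {suc n} c f rewrite sum-*ˡ c (λ i → f (Fin.suc i)) =
  sym (*-distribˡ-+ c (f Fin.zero) _)

sum-const : ∀ n c → ∑[ i < n ] c ≡ n * c
sum-const zero    c = refl
sum-const (suc n) c = cong (c +_) (sum-const n c)

sum-↑ : ∀ m n (f : Fin (m + n) → ℕ) →
        sum f ≡ ∑[ i < m ] f (i ↑ˡ n) + ∑[ j < n ] f (m ↑ʳ j)
sum-↑ zero    n f = refl
sum-↑ (suc m) n f rewrite sum-↑ m n (λ i → f (Fin.suc i)) = sym (+-assoc (f Fin.zero) _ _)

sum-range : ∀ p q (f : ℕ → ℕ) →
            ∑[ i < p + q ] f (toℕ i) ≡ ∑[ i < p ] f (toℕ i) + ∑[ j < q ] f (p + toℕ j)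
sum-range p q f = trans (sum-↑ p q (λ i → f (toℕ i)))
  (cong₂ _+_ (sum-cong-≗ {p} (λ i → cong f (Finₚ.toℕ-↑ˡ i q)))
             (sum-cong-≗ {q} (λ j → cong f (Finₚ.toℕ-↑ʳ p j))))

count-point : ∀ {n} (z : Fin n) → ∑[ i < n ] 𝟙 (does (i Finₚ.≟ z)) ≡ 1
count-point {suc n} Fin.zero    = cong suc (sum-zero {n} (λ _ → refl))
count-point {suc n} (Fin.suc z) = count-point z

count-unique : ∀ {n} (P : Fin n → Bool) →
               (∀ i j → P i ≡ true → P j ≡ true → i ≡ j) → ∑[ i < n ] 𝟙 (P i) ≤ 1
count-unique {zero}  P unique = z≤n
count-unique {suc n} P unique with P Fin.zero in P0
... | true  = ≤-reflexive (cong suc (sum-zero none))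
  where
  none : ∀ i → 𝟙 (P (Fin.suc i)) ≡ 0
  none i with P (Fin.suc i) in Pi
  ... | false = refl
  ... | true with unique Fin.zero (Fin.suc i) P0 Pi
  ...   | ()
... | false = count-unique (λ i → P (Fin.suc i))
                (λ i j Pi Pj → Finₚ.suc-injective (unique (Fin.suc i) (Fin.suc j) Pi Pj))

length-filter : ∀ {A : Set} n (g : Fin n → A) (p : A → Bool) →
                length (filterᵇ p (List.tabulate g)) ≡ ∑[ i < n ] 𝟙 (p (g i))
length-filter zero    g p = refl
length-filter (suc n) g p with p (g Fin.zero)
... | true  = cong suc (length-filter n (λ i → g (Fin.suc i)) p)
... | false = length-filter n (λ i → g (Fin.suc i)) p

card-sum : ∀ {n} (S : Subset n) → ∣ S ∣ ≡ ∑[ i < n ] 𝟙 (lookup S i)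
card-sum []          = refl
card-sum (true ∷ S)  = cong suc (card-sum S)
card-sum (false ∷ S) = card-sum S

count-two : ∀ {n} (Q : Fin n → Bool) {y₁ y₂ : Fin n} → y₁ ≢ y₂ →
            Q y₁ ≡ true → Q y₂ ≡ true → 2 ≤ ∑[ y < n ] 𝟙 (Q y)
count-two {n} Q {y₁} {y₂} y₁≢y₂ Qy₁ Qy₂ =
  subst (_≤ ∑[ y < n ] 𝟙 (Q y))
        (trans (∑-distrib-+ (λ y → 𝟙 (does (y Finₚ.≟ y₁))) (λ y → 𝟙 (does (y Finₚ.≟ y₂))))
               (cong₂ _+_ (count-point y₁) (count-point y₂)))
        (sum-mono pointwise)
  where
  pointwise : ∀ y → 𝟙 (does (y Finₚ.≟ y₁)) + 𝟙 (does (y Finₚ.≟ y₂)) ≤ 𝟙 (Q y)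
  pointwise y with y Finₚ.≟ y₁ | y Finₚ.≟ y₂
  ... | yes refl | yes refl = contradiction refl y₁≢y₂
  ... | yes refl | no _     rewrite Qy₁ = ≤-refl
  ... | no _     | yes refl rewrite Qy₂ = ≤-refl
  ... | no _     | no _     = z≤n

𝟙-∨ : ∀ a b → 𝟙 (a ∨ b) ≤ 𝟙 a + 𝟙 b
𝟙-∨ true  b = s≤s z≤n
𝟙-∨ false b = ≤-refl

count-even : ∀ n → ∑[ i < n ] 𝟙 (even (toℕ i)) ≡ ⌈ n /2⌉
count-even zero          = refl
count-even (suc zero)    = refl
count-even (suc (suc n)) = cong suc (count-even n)

sum-last : ∀ n (f : ℕ → ℕ) → ∑[ i < suc n ] f (toℕ i) ≡ ∑[ i < n ] f (toℕ i) + f n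
sum-last n f = trans (sum-init-last (λ i → f (toℕ i)))
  (cong₂ _+_ (sum-cong-≗ {n} (λ i → cong f (Finₚ.toℕ-inject₁ i))) (cong f (Finₚ.toℕ-fromℕ n)))

activeNbrs-sum : ∀ (G : Graph) (A : Fin (order G) → Bool) x →
                 activeNbrs G A x ≡ ∑[ y < order G ] 𝟙 (adj G x y ∧ A y)
activeNbrs-sum G A x = length-filter (order G) (λ y → y) (λ y → adj G x y ∧ A y)

module _ (G : Graph) (k : ℕ) (S : Subset (order G)) where

  active-mono : ∀ x {t t′} → t ≤ t′ → active G k S t x ≡ true → active G k S t′ x ≡ true
  active-mono x {t′ = zero}   z≤n       x-on = x-on
  active-mono x {t′ = suc t′} t≤1+t′    x-on with m≤n⇒m<n∨m≡n t≤1+t′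
  ... | inj₂ refl    = x-on
  ... | inj₁ t<1+t′ rewrite active-mono x (≤-pred t<1+t′) x-on = refl

  activate : ∀ t x → k ≤ activeNbrs G (active G k S t) x → active G k S (suc t) x ≡ true
  activate t x enough rewrite Equivalence.to T-≡ (≤⇒≤ᵇ enough) = ∨-zeroʳ (active G k S t x)

data Supported (G : Graph) (S : Subset (order G)) (rank : Fin (order G) → ℕ)
               (x : Fin (order G)) : Set where
  seeded : lookup S x ≡ true → Supported G S rank x
  fed    : (y₁ y₂ : Fin (order G)) → y₁ ≢ y₂ →
           adj G x y₁ ≡ true → adj G x y₂ ≡ true →
           rank y₁ < rank x → rank y₂ < rank x → Supported G S rank x

-- Upper-bound principle: if a bounded rank function supports every vertex, then
-- S percolates, since every vertex is active by the time equal to its rank.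
ranked-percolation : ∀ (G : Graph) (S : Subset (order G)) (rank : Fin (order G) → ℕ) (R : ℕ) →
                     (∀ x → rank x ≤ R) → (∀ x → Supported G S rank x) → Percolates G 2 S
ranked-percolation G S rank R bounded supported =
  R , λ x → active-mono G 2 S x (bounded x) (reach R x (bounded x))
  where
  reach : ∀ b x → rank x ≤ b → active G 2 S (rank x) x ≡ true
  reach b x r≤b with supported x
  ... | seeded x∈S = active-mono G 2 S x {t′ = rank x} z≤n x∈S
  ... | fed y₁ y₂ y₁≢y₂ x~y₁ x~y₂ r₁<r r₂<r with rank x | r₁<r | r₂<r | r≤b
  ...   | suc p | s≤s r₁≤p | s≤s r₂≤p | s≤s p≤b =
    activate G 2 S p x (subst (2 ≤_) (sym (activeNbrs-sum G _ x))
      (count-two (λ y → adj G x y ∧ active G 2 S p y) y₁≢y₂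
        (cong₂ _∧_ x~y₁ (earlier y₁ r₁≤p)) (cong₂ _∧_ x~y₂ (earlier y₂ r₂≤p))))
    where
    earlier : ∀ y → rank y ≤ p → active G 2 S p y ≡ true
    earlier y r≤p = active-mono G 2 S y r≤p (reach _ y (≤-trans r≤p p≤b))

nonseeds : ∀ {n} → Subset n → ℕ
nonseeds {n} S = ∑[ x < n ] 𝟙 (not (lookup S x))

degree : (G : Graph) → Fin (order G) → ℕ
degree G x = ∑[ y < order G ] 𝟙 (adj G x y)

-- The least t ≤ n with f t = true (or n if there is none); the time at which
-- a Boolean signal first switches on.
firstTrue : (ℕ → Bool) → ℕ → ℕ
firstTrue f zero    = 0
firstTrue f (suc n) with f 0
... | true  = 0
... | false = suc (firstTrue (λ t → f (suc t)) n)

firstTrue-holds : ∀ (f : ℕ → Bool) n → f n ≡ true → f (firstTrue f n) ≡ true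
firstTrue-holds f zero    fn = fn
firstTrue-holds f (suc n) fn with f 0 in f0
... | true  = f0
... | false = firstTrue-holds (λ t → f (suc t)) n fn

firstTrue-least : ∀ (f : ℕ → Bool) n t → t < firstTrue f n → f t ≡ false
firstTrue-least f (suc n) t       t<first with f 0 in f0
firstTrue-least f (suc n) zero    t<first       | false = f0
firstTrue-least f (suc n) (suc t) (s≤s t<first) | false =
  firstTrue-least (λ t → f (suc t)) n t t<first

-- How the two units of an edge xy are split between its endpoints, given their
-- activation times a (of x) and b (of y): the later endpoint takes both, a tie
-- splits them evenly.
share : ℕ → ℕ → ℕ
share zero    zero    = 1
share zero    (suc b) = 0
share (suc a) zero    = 2
share (suc a) (suc b) = share a b

share-total : ∀ a b → share a b + share b a ≡ 2
share-total zero    zero    = refl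
share-total zero    (suc b) = refl
share-total (suc a) zero    = refl
share-total (suc a) (suc b) = share-total a b

share-later : ∀ {a b} → b < a → share a b ≡ 2
share-later {suc a} {zero}  _         = refl
share-later {suc a} {suc b} (s≤s b<a) = share-later b<a

share-notEarlier : ∀ {a b} → b ≤ a → 1 ≤ share a b
share-notEarlier {zero}  {zero}  _         = s≤s z≤n
share-notEarlier {suc a} {zero}  _         = s≤s z≤n
share-notEarlier {suc a} {suc b} (s≤s b≤a) = share-notEarlier b≤a

-- Every edge carries two units, distributed by `share` according to the
-- activation times τ of its endpoints; the `load` of a vertex is what it
-- receives, so the loads add up to the sum of the degrees.  A non-seed was
-- activated by two earlier neighbours and so has load at least 4, and the
-- vertex activated last, besides two units from each earlier neighbour, gets
-- at least one unit from every one of its edges.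
module LowerBound (G : Graph) (symmetric : ∀ x y → adj G x y ≡ adj G y x)
                  (subcubic : ∀ x → degree G x ≤ 3) (S : Subset (order G))
                  (t₀ : ℕ) (all-active : ∀ x → active G 2 S t₀ x ≡ true) where

  n : ℕ
  n = order G

  act : ℕ → Fin n → Bool
  act = active G 2 S

  τ : Fin n → ℕ
  τ x = firstTrue (λ t → act t x) t₀

  τ-active : ∀ x → act (τ x) x ≡ true
  τ-active x = firstTrue-holds (λ t → act t x) t₀ (all-active x)

  τ-least : ∀ p y → act p y ≡ true → τ y ≤ p
  τ-least p y y-on with τ y ≤? p
  ... | yes τ≤p = τ≤p
  ... | no  τ≰p with trans (sym y-on) (firstTrue-least (λ t → act t y) t₀ p (≰⇒> τ≰p))
  ...   | ()

  activeCount : ℕ → Fin n → ℕ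
  activeCount p x = ∑[ y < n ] 𝟙 (adj G x y ∧ act p y)

  nonseed-activation : ∀ x → lookup S x ≡ false → ∃[ p ] (τ x ≡ suc p × 2 ≤ activeCount p x)
  nonseed-activation x x∉S with τ x in τx≡ | τ-active x
  ... | zero  | x-on with trans (sym x∉S) x-on
  ...   | ()
  nonseed-activation x x∉S | suc p | x-on = p , refl , subst (2 ≤_) (activeNbrs-sum G (act p) x)
          (≤ᵇ⇒≤ 2 _ (Equivalence.from T-≡ (fired (act p x) x-off x-on)))
    where
    x-off : act p x ≡ false
    x-off = firstTrue-least (λ t → act t x) t₀ p (subst (p <_) (sym τx≡) ≤-refl)
    fired : ∀ b {c} → b ≡ false → b ∨ c ≡ true → c ≡ true
    fired false refl c≡true = c≡true

  load : Fin n → ℕ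
  load x = ∑[ y < n ] (𝟙 (adj G x y) * share (τ x) (τ y))

  load-total : sum load ≡ sum (degree G)
  load-total = *-cancelˡ-≡ _ _ 2 (begin
    2 * sum load
      ≡⟨ cong (sum load +_) (+-identityʳ (sum load)) ⟩
    sum load + sum load
      ≡⟨ cong (sum load +_) (∑-comm w) ⟩
    sum load + ∑[ x < n ] ∑[ y < n ] w y x
      ≡⟨ sym (∑-distrib-+ load _) ⟩
    ∑[ x < n ] (load x + ∑[ y < n ] w y x)
      ≡⟨ sum-cong-≗ (λ x → trans (sym (∑-distrib-+ (w x) _)) (sum-cong-≗ (both-ends x))) ⟩
    ∑[ x < n ] ∑[ y < n ] (𝟙 (adj G x y) + 𝟙 (adj G x y))
      ≡⟨ sum-cong-≗ (λ x → ∑-distrib-+ (λ y → 𝟙 (adj G x y)) (λ y → 𝟙 (adj G x y))) ⟩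
    ∑[ x < n ] (degree G x + degree G x)
      ≡⟨ ∑-distrib-+ (degree G) (degree G) ⟩
    sum (degree G) + sum (degree G)
      ≡⟨ cong (sum (degree G) +_) (sym (+-identityʳ (sum (degree G)))) ⟩
    2 * sum (degree G) ∎)
    where
    open ≡-Reasoning
    w : Fin n → Fin n → ℕ
    w x y = 𝟙 (adj G x y) * share (τ x) (τ y)
    both-ends : ∀ x y → w x y + w y x ≡ 𝟙 (adj G x y) + 𝟙 (adj G x y)
    both-ends x y = begin
      𝟙 (adj G x y) * share (τ x) (τ y) + 𝟙 (adj G y x) * share (τ y) (τ x)
        ≡⟨ cong (λ e → 𝟙 (adj G x y) * share (τ x) (τ y) + 𝟙 e * share (τ y) (τ x)) (symmetric y x) ⟩
      𝟙 (adj G x y) * share (τ x) (τ y) + 𝟙 (adj G x y) * share (τ y) (τ x)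
        ≡⟨ sym (*-distribˡ-+ (𝟙 (adj G x y)) _ _) ⟩
      𝟙 (adj G x y) * (share (τ x) (τ y) + share (τ y) (τ x))
        ≡⟨ cong (𝟙 (adj G x y) *_) (share-total (τ x) (τ y)) ⟩
      𝟙 (adj G x y) * 2
        ≡⟨ *-comm (𝟙 (adj G x y)) 2 ⟩
      2 * 𝟙 (adj G x y)
        ≡⟨ cong (𝟙 (adj G x y) +_) (+-identityʳ (𝟙 (adj G x y))) ⟩
      𝟙 (adj G x y) + 𝟙 (adj G x y) ∎

  load-activated : ∀ x p → τ x ≡ suc p → activeCount p x + activeCount p x ≤ load x
  load-activated x p τx≡ =
    subst (_≤ load x) (∑-distrib-+ (λ y → 𝟙 (adj G x y ∧ act p y)) (λ y → 𝟙 (adj G x y ∧ act p y)))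
          (sum-mono pointwise)
    where
    pointwise : ∀ y → 𝟙 (adj G x y ∧ act p y) + 𝟙 (adj G x y ∧ act p y)
                      ≤ 𝟙 (adj G x y) * share (τ x) (τ y)
    pointwise y with adj G x y | act p y in y-on
    ... | false | _     = z≤n
    ... | true  | false = z≤n
    ... | true  | true  rewrite τx≡ | share-later (s≤s (τ-least p y y-on)) = ≤-refl

  load-last : ∀ x p → τ x ≡ suc p → (∀ y → τ y ≤ τ x) → degree G x + activeCount p x ≤ load x
  load-last x p τx≡ last =
    subst (_≤ load x) (∑-distrib-+ (λ y → 𝟙 (adj G x y)) (λ y → 𝟙 (adj G x y ∧ act p y)))
          (sum-mono pointwise)
    where
    pointwise : ∀ y → 𝟙 (adj G x y) + 𝟙 (adj G x y ∧ act p y)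
                      ≤ 𝟙 (adj G x y) * share (τ x) (τ y)
    pointwise y with adj G x y | act p y in y-on
    ... | false | _     = z≤n
    ... | true  | false rewrite +-identityʳ (share (τ x) (τ y)) = share-notEarlier (last y)
    ... | true  | true  rewrite τx≡ | share-later (s≤s (τ-least p y y-on)) = ≤-refl

  -- What each vertex must be paid in the final count; z is meant to be a
  -- non-seed activated last.
  demand : Fin n → Fin n → ℕ
  demand z x = 4 * 𝟙 (not (lookup S x)) + degree G x + 𝟙 (does (x Finₚ.≟ z))

  demand≤load : ∀ z → lookup S z ≡ false → (∀ y → τ y ≤ τ z) → ∀ x → demand z x ≤ load x + 3
  demand≤load z z∉S latest x with lookup S x in x∈S?
  demand≤load z z∉S latest x | true with x Finₚ.≟ z
  ... | yes refl with trans (sym x∈S?) z∉S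
  ...   | ()
  demand≤load z z∉S latest x | true | no _ rewrite +-identityʳ (degree G x) =
    ≤-trans (subcubic x) (m≤n+m 3 (load x))
  demand≤load z z∉S latest x | false with nonseed-activation x x∈S? | x Finₚ.≟ z
  ... | p , τx≡ , two | no _ rewrite +-identityʳ (degree G x) = begin
    4 + degree G x                      ≤⟨ +-monoʳ-≤ 4 (subcubic x) ⟩
    3 + 4                               ≤⟨ +-monoʳ-≤ 3 (≤-trans (+-mono-≤ two two) (load-activated x p τx≡)) ⟩
    3 + load x                          ≡⟨ +-comm 3 (load x) ⟩
    load x + 3                          ∎
    where open ≤-Reasoning
  ... | p , τx≡ , two | yes refl = begin
    4 + degree G x + 1                  ≡⟨ cong (_+ 1) (+-comm 4 (degree G x)) ⟩
    degree G x + 4 + 1                  ≡⟨ +-assoc (degree G x) 4 1 ⟩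
    degree G x + (2 + 3)                ≤⟨ +-monoʳ-≤ (degree G x) (+-monoˡ-≤ 3 two) ⟩
    degree G x + (activeCount p x + 3)  ≡⟨ sym (+-assoc (degree G x) _ 3) ⟩
    degree G x + activeCount p x + 3    ≤⟨ +-monoˡ-≤ 3 (load-last x p τx≡ latest) ⟩
    load x + 3                          ∎
    where open ≤-Reasoning

  total-demand : ∀ z → sum (demand z) ≡ 4 * nonseeds S + sum (degree G) + 1
  total-demand z = begin
    sum (demand z)
      ≡⟨ ∑-distrib-+ (λ x → 4 * 𝟙 (not (lookup S x)) + degree G x) (λ x → 𝟙 (does (x Finₚ.≟ z))) ⟩
    ∑[ x < n ] (4 * 𝟙 (not (lookup S x)) + degree G x) + ∑[ x < n ] 𝟙 (does (x Finₚ.≟ z))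
      ≡⟨ cong₂ _+_ (∑-distrib-+ (λ x → 4 * 𝟙 (not (lookup S x))) (degree G)) (count-point z) ⟩
    ∑[ x < n ] (4 * 𝟙 (not (lookup S x))) + sum (degree G) + 1
      ≡⟨ cong (λ c → c + sum (degree G) + 1) (sum-*ˡ 4 (λ x → 𝟙 (not (lookup S x)))) ⟩
    4 * nonseeds S + sum (degree G) + 1 ∎
    where open ≡-Reasoning

  total-supply : ∑[ x < n ] (load x + 3) ≡ sum (degree G) + 3 * n
  total-supply = begin
    ∑[ x < n ] (load x + 3)  ≡⟨ ∑-distrib-+ load (λ _ → 3) ⟩
    sum load + ∑[ x < n ] 3  ≡⟨ cong₂ _+_ load-total (trans (sum-const n 3) (*-comm n 3)) ⟩
    sum (degree G) + 3 * n   ∎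
    where open ≡-Reasoning

  -- The counting argument, once some vertex x₀ is known not to be a seed: a
  -- vertex z activated last is then not a seed either.
  nonseed-bound : ∀ x₀ → lookup S x₀ ≡ false → 4 * nonseeds S + 1 ≤ 3 * n
  nonseed-bound x₀ x₀∉S = +-cancelˡ-≤ D _ _ (begin
    D + (4 * nonseeds S + 1)   ≡⟨ rearrange D (4 * nonseeds S) ⟩
    4 * nonseeds S + D + 1     ≡⟨ sym (total-demand z) ⟩
    sum (demand z)             ≤⟨ sum-mono (demand≤load z z∉S latest) ⟩
    ∑[ x < n ] (load x + 3)    ≡⟨ total-supply ⟩
    D + 3 * n                  ∎)
    where
    open ≤-Reasoning
    D = sum (degree G)
    rearrange : ∀ d c → d + (c + 1) ≡ c + d + 1
    rearrange d c rewrite +-comm c d = sym (+-assoc d c 1)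
    z : Fin n
    z = argmax τ x₀ (allFin n)
    latest : ∀ x → τ x ≤ τ z
    latest x = All.lookup (f[xs]≤f[argmax] x₀ (allFin n)) (∈-allFin x)
    z∉S : lookup S z ≡ false
    z∉S with nonseed-activation x₀ x₀∉S
    ... | _ , τx₀≡ , _ = firstTrue-least (λ t → act t z) t₀ 0
                           (≤-trans (s≤s z≤n) (subst (_≤ τ z) τx₀≡ (latest x₀)))

seeds+nonseeds : ∀ {n} (S : Subset n) → ∣ S ∣ + nonseeds S ≡ n
seeds+nonseeds {n} S = begin
  ∣ S ∣ + nonseeds S
    ≡⟨ cong (_+ nonseeds S) (card-sum S) ⟩
  ∑[ x < n ] 𝟙 (lookup S x) + ∑[ x < n ] 𝟙 (not (lookup S x))
    ≡⟨ sym (∑-distrib-+ (λ x → 𝟙 (lookup S x)) (λ x → 𝟙 (not (lookup S x)))) ⟩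
  ∑[ x < n ] (𝟙 (lookup S x) + 𝟙 (not (lookup S x)))
    ≡⟨ sum-cong-≗ (λ x → one (lookup S x)) ⟩
  ∑[ x < n ] 1
    ≡⟨ trans (sum-const n 1) (*-identityʳ n) ⟩
  n ∎
  where
  open ≡-Reasoning
  one : ∀ b → 𝟙 b + 𝟙 (not b) ≡ 1
  one true  = refl
  one false = refl

subcubic-lower-bound : ∀ (G : Graph) → (∀ x y → adj G x y ≡ adj G y x) → (∀ x → degree G x ≤ 3) →
                       ∀ (S : Subset (order G)) → 1 ≤ order G → Percolates G 2 S →
                       order G + 1 ≤ 4 * ∣ S ∣
subcubic-lower-bound G symmetric subcubic S 1≤n (t₀ , all-active)
  with Finₚ.all? (λ x → lookup S x Boolₚ.≟ true)
... | yes all-seeds = begin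
  n + 1      ≤⟨ +-monoʳ-≤ n (≤-trans 1≤n (m≤m+n n _)) ⟩
  4 * n      ≡⟨ cong (4 *_) (sym ∣S∣≡n) ⟩
  4 * ∣ S ∣  ∎
  where
  open ≤-Reasoning
  n = order G
  ∣S∣≡n : ∣ S ∣ ≡ n
  ∣S∣≡n = trans (sym (+-identityʳ ∣ S ∣))
    (trans (cong (∣ S ∣ +_) (sym (sum-zero (λ x → cong (λ b → 𝟙 (not b)) (all-seeds x)))))
           (seeds+nonseeds S))
... | no not-all with Finₚ.¬∀⟶∃¬ (order G) (λ x → lookup S x ≡ true) (λ x → lookup S x Boolₚ.≟ true) not-all
...   | x₀ , x₀∉S = subst (λ n → n + 1 ≤ 4 * q) (seeds+nonseeds S) (+-cancelˡ-≤ (3 * N) _ _ (begin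
  3 * N + (q + N + 1)       ≡⟨ regroupˡ q N ⟩
  q + (4 * N + 1)           ≤⟨ +-monoʳ-≤ q (subst (λ n → 4 * N + 1 ≤ 3 * n) (sym (seeds+nonseeds S)) counted) ⟩
  q + 3 * (q + N)           ≡⟨ regroupʳ q N ⟩
  3 * N + 4 * q             ∎))
  where
  open ≤-Reasoning
  q = ∣ S ∣
  N = nonseeds S
  counted : 4 * N + 1 ≤ 3 * order G
  counted = LowerBound.nonseed-bound G symmetric subcubic S t₀ all-active x₀ (Boolₚ.¬-not x₀∉S)
  regroupˡ : ∀ q N → 3 * N + (q + N + 1) ≡ q + (4 * N + 1)
  regroupˡ = solve-∀
  regroupʳ : ∀ q N → q + 3 * (q + N) ≡ 3 * N + 4 * q
  regroupʳ = solve-∀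

outer : ∀ {m} → Fin m → Fin (m + m)
outer {m} i = i ↑ˡ m

inner : ∀ {m} → Fin m → Fin (m + m)
inner {m} i = m ↑ʳ i

by-side : ∀ {m} (Q : Fin (m + m) → Set) → (∀ i → Q (outer i)) → (∀ i → Q (inner i)) → ∀ x → Q x
by-side {m} Q on-outer on-inner x with splitAt m x in split
... | inj₁ i = subst Q (Finₚ.splitAt⁻¹-↑ˡ split) (on-outer i)
... | inj₂ i = subst Q (Finₚ.splitAt⁻¹-↑ʳ split) (on-inner i)

module _ (m s : ℕ) (i j : Fin m) where

  adj-outer-outer : petersenAdj m s (outer i) (outer j) ≡ jump m 1 (toℕ i) (toℕ j)
  adj-outer-outer rewrite Finₚ.splitAt-↑ˡ m i m | Finₚ.splitAt-↑ˡ m j m = refl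

  adj-inner-inner : petersenAdj m s (inner i) (inner j) ≡ jump m s (toℕ i) (toℕ j)
  adj-inner-inner rewrite Finₚ.splitAt-↑ʳ m m i | Finₚ.splitAt-↑ʳ m m j = refl

  adj-outer-inner : petersenAdj m s (outer i) (inner j) ≡ (toℕ i ≡ᵇ toℕ j)
  adj-outer-inner rewrite Finₚ.splitAt-↑ˡ m i m | Finₚ.splitAt-↑ʳ m m j = refl

  adj-inner-outer : petersenAdj m s (inner i) (outer j) ≡ (toℕ i ≡ᵇ toℕ j)
  adj-inner-outer rewrite Finₚ.splitAt-↑ʳ m m i | Finₚ.splitAt-↑ˡ m j m = refl

jump-symmetric : ∀ m d i j → jump m d i j ≡ jump m d j i
jump-symmetric zero    d i j = refl
jump-symmetric (suc m) d i j = Boolₚ.∨-comm ((i + d) % suc m ≡ᵇ j) ((j + d) % suc m ≡ᵇ i)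

jump-forward : ∀ m d k → k + d < m → jump m d k (k + d) ≡ true
jump-forward (suc m) d k k+d<m rewrite m<n⇒m%n≡m k+d<m | ≡ᵇ-refl (k + d) = refl

jump-wrap : ∀ m d k r → r < m → k + d ≡ r + m → jump m d k r ≡ true
jump-wrap (suc m) d k r r<m wraps rewrite wraps | [m+n]%n≡m%n r (suc m) {{_}} | m<n⇒m%n≡m r<m
  | ≡ᵇ-refl r = refl

jump-degree : ∀ m d (i : Fin m) → d ≤ m → ∑[ j < m ] 𝟙 (jump m d (toℕ i) (toℕ j)) ≤ 2
jump-degree (suc m) d i d≤m = begin
  ∑[ j < suc m ] 𝟙 (forward j ∨ backward j)
    ≤⟨ sum-mono (λ j → 𝟙-∨ (forward j) (backward j)) ⟩
  ∑[ j < suc m ] (𝟙 (forward j) + 𝟙 (backward j))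
    ≡⟨ ∑-distrib-+ (λ j → 𝟙 (forward j)) (λ j → 𝟙 (backward j)) ⟩
  ∑[ j < suc m ] 𝟙 (forward j) + ∑[ j < suc m ] 𝟙 (backward j)
    ≤⟨ +-mono-≤ (count-unique forward forward-unique) (count-unique backward backward-unique) ⟩
  2 ∎
  where
  open ≤-Reasoning
  forward backward : Fin (suc m) → Bool
  forward  j = (toℕ i + d) % suc m ≡ᵇ toℕ j
  backward j = (toℕ j + d) % suc m ≡ᵇ toℕ i
  forward-unique : ∀ j k → forward j ≡ true → forward k ≡ true → j ≡ k
  forward-unique j k fj fk = Finₚ.toℕ-injective
    (trans (sym (≡ᵇ-true ((toℕ i + d) % suc m) (toℕ j) fj)) (≡ᵇ-true ((toℕ i + d) % suc m) (toℕ k) fk))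
  backward-unique : ∀ j k → backward j ≡ true → backward k ≡ true → j ≡ k
  backward-unique j k bj bk = Finₚ.toℕ-injective
    (translate-injective (suc m) d (Finₚ.toℕ<n j) (Finₚ.toℕ<n k) d≤m
      (trans (≡ᵇ-true _ (toℕ i) bj) (sym (≡ᵇ-true _ (toℕ i) bk))))

petersen-symmetric : ∀ m s x y → petersenAdj m s x y ≡ petersenAdj m s y x
petersen-symmetric m s x y with splitAt m x | splitAt m y
... | inj₁ i | inj₁ j = jump-symmetric m 1 (toℕ i) (toℕ j)
... | inj₂ i | inj₂ j = jump-symmetric m s (toℕ i) (toℕ j)
... | inj₁ i | inj₂ j = ≡ᵇ-sym (toℕ i) (toℕ j)
... | inj₂ i | inj₁ j = ≡ᵇ-sym (toℕ i) (toℕ j)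

spoke-degree : ∀ m (i : Fin m) → ∑[ j < m ] 𝟙 (toℕ i ≡ᵇ toℕ j) ≤ 1
spoke-degree m i = count-unique {m} (λ j → toℕ i ≡ᵇ toℕ j)
  (λ j k ij ik → Finₚ.toℕ-injective (trans (sym (≡ᵇ-true (toℕ i) (toℕ j) ij)) (≡ᵇ-true (toℕ i) (toℕ k) ik)))

petersen-subcubic : ∀ m s → 1 ≤ m → s ≤ m → ∀ x → degree (P m s) x ≤ 3
petersen-subcubic m s 1≤m s≤m = by-side (λ x → degree (P m s) x ≤ 3) outer-degree inner-degree
  where
  open ≤-Reasoning
  outer-degree : ∀ i → degree (P m s) (outer i) ≤ 3
  outer-degree i = begin
    degree (P m s) (outer i)
      ≡⟨ sum-↑ m m (λ y → 𝟙 (petersenAdj m s (outer i) y)) ⟩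
    ∑[ j < m ] 𝟙 (petersenAdj m s (outer i) (outer j)) + ∑[ j < m ] 𝟙 (petersenAdj m s (outer i) (inner j))
      ≡⟨ cong₂ _+_ (sum-cong-≗ (λ j → cong 𝟙 (adj-outer-outer m s i j)))
                   (sum-cong-≗ (λ j → cong 𝟙 (adj-outer-inner m s i j))) ⟩
    ∑[ j < m ] 𝟙 (jump m 1 (toℕ i) (toℕ j)) + ∑[ j < m ] 𝟙 (toℕ i ≡ᵇ toℕ j)
      ≤⟨ +-mono-≤ (jump-degree m 1 i 1≤m) (spoke-degree m i) ⟩
    3 ∎
  inner-degree : ∀ i → degree (P m s) (inner i) ≤ 3
  inner-degree i = begin
    degree (P m s) (inner i)
      ≡⟨ sum-↑ m m (λ y → 𝟙 (petersenAdj m s (inner i) y)) ⟩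
    ∑[ j < m ] 𝟙 (petersenAdj m s (inner i) (outer j)) + ∑[ j < m ] 𝟙 (petersenAdj m s (inner i) (inner j))
      ≡⟨ cong₂ _+_ (sum-cong-≗ (λ j → cong 𝟙 (adj-inner-outer m s i j)))
                   (sum-cong-≗ (λ j → cong 𝟙 (adj-inner-inner m s i j))) ⟩
    ∑[ j < m ] 𝟙 (toℕ i ≡ᵇ toℕ j) + ∑[ j < m ] 𝟙 (jump m s (toℕ i) (toℕ j))
      ≤⟨ +-mono-≤ (spoke-degree m i) (jump-degree m s i s≤m) ⟩
    3 ∎

-- Upper bound: an explicit percolating set of size ⌈(m+1)/2⌉ in P(m,s) for
-- m = a + 2s with a ≥ 1.  The seeds are the outer vertices v_k with k < a that
-- are even or equal to a - 1, and the inner vertices u_k with a ≤ k < a + s.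
-- The certificate is a rank function: odd v_k (k < a) follow from their seeded
-- outer neighbours, u_k (k < a) from v_k and u_{k+s} (a seed or lower), v_k
-- (a ≤ k) from v_{k-1} and its spoke u_k (a seed when k < a + s), and u_k
-- (a + s ≤ k) from the seeded u_{k-s} and from u_{k+s-m}.
module Construction (a′ s : ℕ) (1≤s : 1 ≤ s) where

  a : ℕ
  a = suc a′

  m : ℕ
  m = a + s + s

  G : Graph
  G = P m s

  a+s≤m : a + s ≤ m
  a+s≤m = m≤m+n (a + s) s

  a≤m : a ≤ m
  a≤m = ≤-trans (m≤m+n a s) a+s≤m

  a+2≤m : a + 2 ≤ m
  a+2≤m = ≤-trans (+-monoʳ-≤ a (+-mono-≤ 1≤s 1≤s)) (≤-reflexive (sym (+-assoc a s s)))

  v u : (k : ℕ) → k < m → Fin (m + m)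
  v k k<m = outer (Fin.fromℕ< k<m)
  u k k<m = inner (Fin.fromℕ< k<m)

  v≢u : ∀ {k k′} (p : k < m) (p′ : k′ < m) → v k p ≢ u k′ p′
  v≢u {k} {k′} p p′ v≡u = <⇒≱ p (begin
    m                      ≤⟨ m≤m+n m k′ ⟩
    m + k′                 ≡⟨ cong (m +_) (sym (Finₚ.toℕ-fromℕ< p′)) ⟩
    m + toℕ (Fin.fromℕ< p′) ≡⟨ sym (Finₚ.toℕ-↑ʳ m (Fin.fromℕ< p′)) ⟩
    toℕ (u k′ p′)          ≡⟨ cong toℕ (sym v≡u) ⟩
    toℕ (v k p)            ≡⟨ Finₚ.toℕ-↑ˡ (Fin.fromℕ< p) m ⟩
    toℕ (Fin.fromℕ< p)     ≡⟨ Finₚ.toℕ-fromℕ< p ⟩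
    k                      ∎)
    where open ≤-Reasoning

  v-injective : ∀ {k k′} (p : k < m) (p′ : k′ < m) → v k p ≡ v k′ p′ → k ≡ k′
  v-injective p p′ v≡v = trans (sym (Finₚ.toℕ-fromℕ< p))
    (trans (cong toℕ (Finₚ.↑ˡ-injective m _ _ v≡v)) (Finₚ.toℕ-fromℕ< p′))

  u-injective : ∀ {k k′} (p : k < m) (p′ : k′ < m) → u k p ≡ u k′ p′ → k ≡ k′
  u-injective p p′ u≡u = trans (sym (Finₚ.toℕ-fromℕ< p))
    (trans (cong toℕ (Finₚ.↑ʳ-injective m _ _ u≡u)) (Finₚ.toℕ-fromℕ< p′))

  outer-next : ∀ {k} (p : k < m) (q : suc k < m) → adj G (v k p) (v (suc k) q) ≡ true
  outer-next {k} p q = trans (adj-outer-outer m s (Fin.fromℕ< p) (Fin.fromℕ< q))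
    (trans (cong₂ (jump m 1) (Finₚ.toℕ-fromℕ< p) (Finₚ.toℕ-fromℕ< q))
           (subst (λ j → jump m 1 k j ≡ true) (+-comm k 1)
                  (jump-forward m 1 k (subst (_< m) (+-comm 1 k) q))))

  outer-prev : ∀ {k} (p : k < m) (q : suc k < m) → adj G (v (suc k) q) (v k p) ≡ true
  outer-prev {k} p q = trans (petersen-symmetric m s (v (suc k) q) (v k p)) (outer-next p q)

  spoke : ∀ {k} (p : k < m) → adj G (v k p) (u k p) ≡ true
  spoke {k} p = trans (adj-outer-inner m s (Fin.fromℕ< p) (Fin.fromℕ< p)) (≡ᵇ-refl (toℕ (Fin.fromℕ< p)))

  spoke′ : ∀ {k} (p : k < m) → adj G (u k p) (v k p) ≡ true
  spoke′ {k} p = trans (adj-inner-outer m s (Fin.fromℕ< p) (Fin.fromℕ< p)) (≡ᵇ-refl (toℕ (Fin.fromℕ< p)))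

  inner-next : ∀ {k} (p : k < m) (q : k + s < m) → adj G (u k p) (u (k + s) q) ≡ true
  inner-next {k} p q = trans (adj-inner-inner m s (Fin.fromℕ< p) (Fin.fromℕ< q))
    (trans (cong₂ (jump m s) (Finₚ.toℕ-fromℕ< p) (Finₚ.toℕ-fromℕ< q)) (jump-forward m s k q))

  inner-prev : ∀ {k} (p : k < m) (q : k + s < m) → adj G (u (k + s) q) (u k p) ≡ true
  inner-prev {k} p q = trans (petersen-symmetric m s (u (k + s) q) (u k p)) (inner-next p q)

  inner-wrap : ∀ {k r} (p : k < m) (q : r < m) → k + s ≡ r + m → adj G (u k p) (u r q) ≡ true
  inner-wrap {k} {r} p q wraps = trans (adj-inner-inner m s (Fin.fromℕ< p) (Fin.fromℕ< q))
    (trans (cong₂ (jump m s) (Finₚ.toℕ-fromℕ< p) (Finₚ.toℕ-fromℕ< q)) (jump-wrap m s k r q wraps))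

  side : {A : Set} → (ℕ → A) → (ℕ → A) → Fin (m + m) → A
  side f g x = [ (λ i → f (toℕ i)) , (λ i → g (toℕ i)) ]′ (splitAt m x)

  side-outer : ∀ {A : Set} (f g : ℕ → A) i → side f g (outer i) ≡ f (toℕ i)
  side-outer f g i rewrite Finₚ.splitAt-↑ˡ m i m = refl

  side-inner : ∀ {A : Set} (f g : ℕ → A) i → side f g (inner i) ≡ g (toℕ i)
  side-inner f g i rewrite Finₚ.splitAt-↑ʳ m m i = refl

  side-v : ∀ {A : Set} (f g : ℕ → A) {k} (p : k < m) → side f g (v k p) ≡ f k
  side-v f g p = trans (side-outer f g (Fin.fromℕ< p)) (cong f (Finₚ.toℕ-fromℕ< p))

  side-u : ∀ {A : Set} (f g : ℕ → A) {k} (p : k < m) → side f g (u k p) ≡ g k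
  side-u f g p = trans (side-inner f g (Fin.fromℕ< p)) (cong g (Finₚ.toℕ-fromℕ< p))

  lowSeed : ℕ → Bool
  lowSeed k = even k ∨ (suc k ≡ᵇ a)

  outerSeed innerSeed : ℕ → Bool
  outerSeed k = (k <ᵇ a) ∧ lowSeed k
  innerSeed k = (a ≤ᵇ k) ∧ (k <ᵇ a + s)

  outerRank innerRank : ℕ → ℕ
  outerRank k = if k <ᵇ a then (if lowSeed k then 0 else 1)
                else if k <ᵇ a + s then k ∸ a + 2 else m + k
  innerRank k = if k <ᵇ a then 2 + (a ∸ k) else if k <ᵇ a + s then 0 else a + 3

  seeds : Subset (m + m)
  seeds = tabulate (side outerSeed innerSeed)

  rank : Fin (m + m) → ℕ
  rank = side outerRank innerRank

  outerRank-seed : ∀ {k} → k < a → lowSeed k ≡ true → outerRank k ≡ 0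
  outerRank-seed k<a seed rewrite <ᵇ-true k<a | seed = refl

  outerRank-gap : ∀ {k} → k < a → lowSeed k ≡ false → outerRank k ≡ 1
  outerRank-gap k<a gap rewrite <ᵇ-true k<a | gap = refl

  outerRank-low : ∀ {k} → k < a → outerRank k ≤ 1
  outerRank-low {k} k<a rewrite <ᵇ-true k<a with lowSeed k
  ... | true  = z≤n
  ... | false = ≤-refl

  outerRank-mid : ∀ {k} → a ≤ k → k < a + s → outerRank k ≡ k ∸ a + 2
  outerRank-mid a≤k k<a+s rewrite <ᵇ-false a≤k | <ᵇ-true k<a+s = refl

  outerRank-high : ∀ {k} → a + s ≤ k → outerRank k ≡ m + k
  outerRank-high a+s≤k rewrite <ᵇ-false (≤-trans (m≤m+n a s) a+s≤k) | <ᵇ-false a+s≤k = refl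

  outerRank-bound : ∀ k → outerRank k ≤ m + k
  outerRank-bound k with k <? a | k <? a + s
  ... | yes k<a | _         = ≤-trans (outerRank-low k<a) (≤-trans (≤-trans (s≤s z≤n) a≤m) (m≤m+n m k))
  ... | no k≮a  | yes k<a+s rewrite outerRank-mid (≮⇒≥ k≮a) k<a+s =
    ≤-trans (+-mono-≤ (m∸n≤m k a) (≤-trans (m≤n+m 2 a) a+2≤m)) (≤-reflexive (+-comm k m))
  ... | no _    | no k≮a+s  rewrite outerRank-high (≮⇒≥ k≮a+s) = ≤-refl

  innerRank-low : ∀ {k} → k < a → innerRank k ≡ 2 + (a ∸ k)
  innerRank-low k<a rewrite <ᵇ-true k<a = refl

  innerRank-mid : ∀ {k} → a ≤ k → k < a + s → innerRank k ≡ 0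
  innerRank-mid a≤k k<a+s rewrite <ᵇ-false a≤k | <ᵇ-true k<a+s = refl

  innerRank-high : ∀ {k} → a + s ≤ k → innerRank k ≡ a + 3
  innerRank-high a+s≤k rewrite <ᵇ-false (≤-trans (m≤m+n a s) a+s≤k) | <ᵇ-false a+s≤k = refl

  innerRank-below : ∀ {k} → k < a + s → innerRank k ≤ a + 2
  innerRank-below {k} k<a+s with k <? a
  ... | yes k<a  rewrite innerRank-low k<a = subst (_≤ a + 2) (+-comm (a ∸ k) 2) (+-monoˡ-≤ 2 (m∸n≤m a k))
  ... | no k≮a   rewrite innerRank-mid (≮⇒≥ k≮a) k<a+s = z≤n

  innerRank-bound : ∀ k → innerRank k ≤ a + 3
  innerRank-bound k with k <? a + s
  ... | yes k<a+s = ≤-trans (innerRank-below k<a+s) (+-monoʳ-≤ a (n≤1+n 2))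
  ... | no k≮a+s  rewrite innerRank-high (≮⇒≥ k≮a+s) = ≤-refl

  Supp : Fin (m + m) → Set
  Supp = Supported G seeds rank

  rank-v : ∀ {k} (p : k < m) → rank (v k p) ≡ outerRank k
  rank-v = side-v outerRank innerRank

  rank-u : ∀ {k} (p : k < m) → rank (u k p) ≡ innerRank k
  rank-u = side-u outerRank innerRank

  ranks : ∀ y x {r r′} → rank y ≡ r → rank x ≡ r′ → r < r′ → rank y < rank x
  ranks y x ry rx = subst₂ _<_ (sym ry) (sym rx)

  seeded-v : ∀ {k} (p : k < m) → outerSeed k ≡ true → Supp (v k p)
  seeded-v p seed = seeded (trans (lookup∘tabulate (side outerSeed innerSeed) (v _ p))
                                  (trans (side-v outerSeed innerSeed p) seed))

  seeded-u : ∀ {k} (p : k < m) → innerSeed k ≡ true → Supp (u k p)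
  seeded-u p seed = seeded (trans (lookup∘tabulate (side outerSeed innerSeed) (u _ p))
                                  (trans (side-u outerSeed innerSeed p) seed))

  support-gap : ∀ k (p : k < m) → k < a → even k ≡ false → (suc k ≡ᵇ a) ≡ false → Supp (v k p)
  support-gap (suc k) p k<a odd not-last =
    fed (v k p₀) (v (suc (suc k)) p₂) (λ eq → n≢2+n k (v-injective p₀ p₂ eq))
        (outer-prev p₀ p) (outer-next p p₂)
        (ranks (v k p₀) x r₀ rx (s≤s z≤n)) (ranks (v (suc (suc k)) p₂) x r₂ rx (s≤s z≤n))
    where
    x = v (suc k) p
    2+k<a : suc (suc k) < a
    2+k<a = ≤∧≢⇒< k<a (≡ᵇ-false not-last)
    p₀ : k < m
    p₀ = <⇒≤ p
    p₂ : suc (suc k) < m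
    p₂ = ≤-trans 2+k<a a≤m
    k-even : even k ≡ true
    k-even = even-pred k odd
    rx : rank x ≡ 1
    rx = trans (rank-v p) (outerRank-gap k<a (cong₂ _∨_ odd not-last))
    r₀ : rank (v k p₀) ≡ 0
    r₀ = trans (rank-v p₀) (outerRank-seed (<⇒≤ k<a) (cong (_∨ (suc k ≡ᵇ a)) k-even))
    r₂ : rank (v (suc (suc k)) p₂) ≡ 0
    r₂ = trans (rank-v p₂) (outerRank-seed 2+k<a (cong (_∨ (suc (suc (suc k)) ≡ᵇ a)) k-even))

  support-outer-mid : ∀ k (p : k < m) → a ≤ k → k < a + s → Supp (v k p)
  support-outer-mid (suc k) p a≤1+k 1+k<a+s =
    fed (v k p₀) (u (suc k) p) (v≢u p₀ p) (outer-prev p₀ p) (spoke p) r₀ r₁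
    where
    x = v (suc k) p
    p₀ : k < m
    p₀ = <⇒≤ p
    rx : rank x ≡ suc k ∸ a + 2
    rx = trans (rank-v p) (outerRank-mid a≤1+k 1+k<a+s)
    r₀ : rank (v k p₀) < rank x
    r₀ with k <? a
    ... | yes k<a = ranks (v k p₀) x (rank-v p₀) rx (≤-trans (s≤s (outerRank-low k<a)) (m≤n+m 2 (suc k ∸ a)))
    ... | no  k≮a = ranks (v k p₀) x (trans (rank-v p₀) (outerRank-mid (≮⇒≥ k≮a) (<⇒≤ 1+k<a+s))) rx
                      (+-monoˡ-≤ 2 (≤-reflexive (sym (+-∸-assoc 1 (≮⇒≥ k≮a)))))
    r₁ : rank (u (suc k) p) < rank x
    r₁ = ranks (u (suc k) p) x (trans (rank-u p) (innerRank-mid a≤1+k 1+k<a+s)) rx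
           (≤-trans (s≤s z≤n) (m≤n+m 2 (suc k ∸ a)))

  support-outer-high : ∀ k (p : k < m) → a + s ≤ k → Supp (v k p)
  support-outer-high (suc k) p a+s≤1+k =
    fed (v k p₀) (u (suc k) p) (v≢u p₀ p) (outer-prev p₀ p) (spoke p) r₀ r₁
    where
    x = v (suc k) p
    p₀ : k < m
    p₀ = <⇒≤ p
    rx : rank x ≡ m + suc k
    rx = trans (rank-v p) (outerRank-high a+s≤1+k)
    r₀ : rank (v k p₀) < rank x
    r₀ = ranks (v k p₀) x (rank-v p₀) rx (subst (outerRank k <_) (sym (+-suc m k)) (s≤s (outerRank-bound k)))
    r₁ : rank (u (suc k) p) < rank x
    r₁ = ranks (u (suc k) p) x (rank-u p) rx (begin-strict
      innerRank (suc k)  ≤⟨ innerRank-bound (suc k) ⟩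
      a + 3              <⟨ +-monoʳ-< a (n<1+n 3) ⟩
      a + 4              ≡⟨ sym (+-assoc a 2 2) ⟩
      a + 2 + 2          ≤⟨ +-mono-≤ a+2≤m (≤-trans (+-mono-≤ (s≤s (z≤n {a′})) 1≤s) a+s≤1+k) ⟩
      m + suc k          ∎)
      where open ≤-Reasoning

  support-inner-low : ∀ k (p : k < m) → k < a → Supp (u k p)
  support-inner-low k p k<a = fed (v k p) (u (k + s) q) (v≢u p q) (spoke′ p) (inner-next p q) r₀ r₁
    where
    x = u k p
    q : k + s < m
    q = ≤-trans (+-monoˡ-< s k<a) a+s≤m
    rx : rank x ≡ 2 + (a ∸ k)
    rx = trans (rank-u p) (innerRank-low k<a)
    r₀ : rank (v k p) < rank x
    r₀ = ranks (v k p) x (rank-v p) rx (≤-trans (s≤s (outerRank-low k<a)) (m≤m+n 2 (a ∸ k)))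
    r₁ : rank (u (k + s) q) < rank x
    r₁ with k + s <? a
    ... | yes k+s<a = ranks (u (k + s) q) x (trans (rank-u q) (innerRank-low k+s<a)) rx
                        (+-monoʳ-< 2 (∸-monoʳ-< (m<m+n k 1≤s) (<⇒≤ k+s<a)))
    ... | no  k+s≮a = ranks (u (k + s) q) x (trans (rank-u q) (innerRank-mid (≮⇒≥ k+s≮a) (+-monoˡ-< s k<a)))
                        rx (s≤s z≤n)

  support-inner-high : ∀ k (p : k < m) → a + s ≤ k → Supp (u k p)
  support-inner-high k p a+s≤k =
    fed (u (a + r) q₁) (u r q₂) (λ eq → a+r≢r (u-injective q₁ q₂ eq)) back wrap r₁ r₂
    where
    x = u k p
    r = k ∸ (a + s)
    k≡ : k ≡ a + s + r
    k≡ = sym (m+[n∸m]≡n a+s≤k)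
    r<s : r < s
    r<s = +-cancelˡ-< (a + s) r s (subst (_< m) k≡ p)
    q₁ : a + r < m
    q₁ = ≤-trans (+-monoʳ-< a r<s) a+s≤m
    q₂ : r < m
    q₂ = ≤-trans r<s (≤-trans (m≤n+m s a) a+s≤m)
    a+r≢r : a + r ≢ r
    a+r≢r eq = <⇒≢ (m<n+m r (s≤s (z≤n {a′}))) (sym eq)
    back : adj G x (u (a + r) q₁) ≡ true
    back = subst (λ j → ∀ (p : j < m) → adj G (u j p) (u (a + r) q₁) ≡ true)
             (trans (regroup a r s) (sym k≡)) (λ p′ → inner-prev q₁ p′) p
      where
      regroup : ∀ a r s → a + r + s ≡ a + s + r
      regroup = solve-∀
    wrap : adj G x (u r q₂) ≡ true
    wrap = inner-wrap p q₂ (trans (cong (_+ s) k≡) (regroup a s r))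
      where
      regroup : ∀ a s r → a + s + r + s ≡ r + (a + s + s)
      regroup = solve-∀
    rx : rank x ≡ a + 3
    rx = trans (rank-u p) (innerRank-high a+s≤k)
    r₁ : rank (u (a + r) q₁) < rank x
    r₁ = ranks (u (a + r) q₁) x (trans (rank-u q₁) (innerRank-mid (m≤m+n a r) (+-monoʳ-< a r<s))) rx (s≤s z≤n)
    r₂ : rank (u r q₂) < rank x
    r₂ = ranks (u r q₂) x (rank-u q₂) rx
           (≤-trans (s≤s (innerRank-below (≤-trans r<s (m≤n+m s a)))) (≤-reflexive (sym (+-suc a 2))))

  support-outer : ∀ k (p : k < m) → Supp (v k p)
  support-outer k p with k <? a | k <? a + s
  ... | yes k<a | _ with lowSeed k in low
  ...   | true  = seeded-v p (trans (cong (_∧ lowSeed k) (<ᵇ-true k<a)) low)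
  ...   | false = support-gap k p k<a (Boolₚ.∨-conicalˡ _ _ low) (Boolₚ.∨-conicalʳ _ _ low)
  support-outer k p | no k≮a | yes k<a+s = support-outer-mid k p (≮⇒≥ k≮a) k<a+s
  support-outer k p | no _   | no k≮a+s  = support-outer-high k p (≮⇒≥ k≮a+s)

  support-inner : ∀ k (p : k < m) → Supp (u k p)
  support-inner k p with k <? a | k <? a + s
  ... | yes k<a | _         = support-inner-low k p k<a
  ... | no k≮a  | yes k<a+s = seeded-u p (cong₂ _∧_ (≤ᵇ-true (≮⇒≥ k≮a)) (<ᵇ-true k<a+s))
  ... | no _    | no k≮a+s  = support-inner-high k p (≮⇒≥ k≮a+s)

  by-index : (Q : Fin (m + m) → Set) → (∀ k p → Q (v k p)) → (∀ k p → Q (u k p)) → ∀ x → Q x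
  by-index Q on-v on-u = by-side Q
    (λ i → subst (λ j → Q (outer j)) (Finₚ.fromℕ<-toℕ i (Finₚ.toℕ<n i)) (on-v (toℕ i) (Finₚ.toℕ<n i)))
    (λ i → subst (λ j → Q (inner j)) (Finₚ.fromℕ<-toℕ i (Finₚ.toℕ<n i)) (on-u (toℕ i) (Finₚ.toℕ<n i)))

  rank-bound : ∀ x → rank x ≤ m + m
  rank-bound = by-index (λ x → rank x ≤ m + m)
    (λ k p → subst (_≤ m + m) (sym (rank-v p)) (≤-trans (outerRank-bound k) (+-monoʳ-≤ m (<⇒≤ p))))
    (λ k p → subst (_≤ m + m) (sym (rank-u p))
               (≤-trans (innerRank-bound k) (+-mono-≤ a≤m (≤-trans (s≤s (m≤n+m 2 a′)) a+2≤m))))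

  percolates : Percolates G 2 seeds
  percolates = ranked-percolation G seeds rank (m + m) rank-bound (by-index Supp support-outer support-inner)

  outerSeed-early : ∀ k → k < a′ → outerSeed k ≡ even k
  outerSeed-early k k<a′ rewrite <ᵇ-true (≤-trans k<a′ (n≤1+n a′))
    | Boolₚ.¬-not (λ k≡ᵇa′ → <⇒≢ k<a′ (≡ᵇ-true k a′ k≡ᵇa′)) = Boolₚ.∨-identityʳ (even k)

  outerSeed-last : outerSeed a′ ≡ true
  outerSeed-last rewrite <ᵇ-true (n<1+n a′) | ≡ᵇ-refl a′ = Boolₚ.∨-zeroʳ (even a′)

  outerSeed-late : ∀ k → a ≤ k → outerSeed k ≡ false
  outerSeed-late k a≤k rewrite <ᵇ-false a≤k = refl

  innerSeed-low : ∀ k → k < a → innerSeed k ≡ false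
  innerSeed-low k k<a rewrite ≤ᵇ-false k<a = refl

  innerSeed-mid : ∀ k → a ≤ k → k < a + s → innerSeed k ≡ true
  innerSeed-mid k a≤k k<a+s rewrite ≤ᵇ-true a≤k | <ᵇ-true k<a+s = refl

  innerSeed-high : ∀ k → a + s ≤ k → innerSeed k ≡ false
  innerSeed-high k a+s≤k rewrite <ᵇ-false a+s≤k = Boolₚ.∧-zeroʳ (a ≤ᵇ k)

  sum-zones : ∀ (f : ℕ → ℕ) → ∑[ i < m ] f (toℕ i) ≡
              ∑[ i < a ] f (toℕ i) + ∑[ j < s ] f (a + toℕ j) + ∑[ j < s ] f (a + s + toℕ j)
  sum-zones f = trans (sum-range (a + s) s f) (cong (_+ ∑[ j < s ] f (a + s + toℕ j)) (sum-range a s f))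

  count-outer : ∑[ i < m ] 𝟙 (outerSeed (toℕ i)) ≡ suc ⌈ a′ /2⌉
  count-outer = begin
    ∑[ i < m ] f (toℕ i)
      ≡⟨ sum-zones f ⟩
    ∑[ i < a ] f (toℕ i) + ∑[ j < s ] f (a + toℕ j) + ∑[ j < s ] f (a + s + toℕ j)
      ≡⟨ cong₂ _+_ (cong₂ _+_ (sum-last a′ f) (sum-zero {s} (λ j → late (m≤m+n a (toℕ j)))))
                   (sum-zero {s} (λ j → late (≤-trans (m≤m+n a s) (m≤m+n (a + s) (toℕ j))))) ⟩
    ∑[ i < a′ ] f (toℕ i) + f a′ + 0 + 0
      ≡⟨ trans (+-identityʳ _) (+-identityʳ _) ⟩
    ∑[ i < a′ ] f (toℕ i) + f a′
      ≡⟨ cong₂ _+_ (sum-cong-≗ {a′} (λ i → cong 𝟙 (outerSeed-early (toℕ i) (Finₚ.toℕ<n i))))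
                   (cong 𝟙 outerSeed-last) ⟩
    ∑[ i < a′ ] 𝟙 (even (toℕ i)) + 1
      ≡⟨ trans (cong (_+ 1) (count-even a′)) (+-comm ⌈ a′ /2⌉ 1) ⟩
    suc ⌈ a′ /2⌉ ∎
    where
    open ≡-Reasoning
    f : ℕ → ℕ
    f k = 𝟙 (outerSeed k)
    late : ∀ {k} → a ≤ k → f k ≡ 0
    late {k} a≤k = cong 𝟙 (outerSeed-late k a≤k)

  count-inner : ∑[ i < m ] 𝟙 (innerSeed (toℕ i)) ≡ s
  count-inner = begin
    ∑[ i < m ] f (toℕ i)
      ≡⟨ sum-zones f ⟩
    ∑[ i < a ] f (toℕ i) + ∑[ j < s ] f (a + toℕ j) + ∑[ j < s ] f (a + s + toℕ j)
      ≡⟨ cong₂ _+_ (cong₂ _+_ (sum-zero {a} (λ i → cong 𝟙 (innerSeed-low (toℕ i) (Finₚ.toℕ<n i))))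
                              (sum-cong-≗ {s} (λ j → cong 𝟙 (innerSeed-mid (a + toℕ j) (m≤m+n a (toℕ j))
                                                                     (+-monoʳ-< a (Finₚ.toℕ<n j))))))
                   (sum-zero {s} (λ j → cong 𝟙 (innerSeed-high (a + s + toℕ j) (m≤m+n (a + s) (toℕ j))))) ⟩
    0 + ∑[ j < s ] 1 + 0
      ≡⟨ trans (+-identityʳ _) (trans (sum-const s 1) (*-identityʳ s)) ⟩
    s ∎
    where
    open ≡-Reasoning
    f : ℕ → ℕ
    f k = 𝟙 (innerSeed k)

  size : ∣ seeds ∣ ≡ ⌈ (m + 1) /2⌉
  size = begin
    ∣ seeds ∣
      ≡⟨ card-sum seeds ⟩
    ∑[ x < m + m ] 𝟙 (lookup seeds x)
      ≡⟨ sum-cong-≗ {m + m} (λ x → cong 𝟙 (lookup∘tabulate (side outerSeed innerSeed) x)) ⟩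
    ∑[ x < m + m ] 𝟙 (side outerSeed innerSeed x)
      ≡⟨ sum-↑ m m (λ x → 𝟙 (side outerSeed innerSeed x)) ⟩
    ∑[ i < m ] 𝟙 (side outerSeed innerSeed (outer i)) + ∑[ i < m ] 𝟙 (side outerSeed innerSeed (inner i))
      ≡⟨ cong₂ _+_ (sum-cong-≗ {m} (λ i → cong 𝟙 (side-outer outerSeed innerSeed i)))
                   (sum-cong-≗ {m} (λ i → cong 𝟙 (side-inner outerSeed innerSeed i))) ⟩
    ∑[ i < m ] 𝟙 (outerSeed (toℕ i)) + ∑[ i < m ] 𝟙 (innerSeed (toℕ i))
      ≡⟨ cong₂ _+_ count-outer count-inner ⟩
    suc ⌈ a′ /2⌉ + s
      ≡⟨ cong suc (sym halving) ⟩
    ⌈ (m + 1) /2⌉ ∎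
    where
    open ≡-Reasoning
    regroup : ∀ a′ s → a′ + s + s + 1 ≡ (s + s) + suc a′
    regroup = solve-∀
    halving : ⌊ a′ + s + s + 1 /2⌋ ≡ ⌈ a′ /2⌉ + s
    halving = trans (cong ⌊_/2⌋ (regroup a′ s)) (trans (half-+ s (suc a′)) (+-comm s ⌈ a′ /2⌉))

  upper-bound : ∃[ S ] (∣ S ∣ ≡ ⌈ (m + 1) /2⌉ × Percolates G 2 S)
  upper-bound = seeds , size , percolates

-- If 2m + 1 ≤ 4q then ⌈(m+1)/2⌉ ≤ q, since q ≤ ⌊m/2⌋ would give 4q ≤ 2m.
ceil-half-bound : ∀ m q → m + m + 1 ≤ 4 * q → ⌈ (m + 1) /2⌉ ≤ q
ceil-half-bound m q 2m+1≤4q = subst (_≤ q) (cong ⌈_/2⌉ (+-comm 1 m)) (≰⇒> too-small)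
  where
  open ≤-Reasoning
  too-small : ¬ (q ≤ ⌊ m /2⌋)
  too-small q≤half = <-irrefl refl (begin-strict
    m + m          <⟨ m<m+n (m + m) (s≤s z≤n) ⟩
    m + m + 1      ≤⟨ 2m+1≤4q ⟩
    4 * q          ≡⟨ quadruple q ⟩
    (q + q) + (q + q)  ≤⟨ +-mono-≤ double≤m double≤m ⟩
    m + m          ∎)
    where
    quadruple : ∀ q → 4 * q ≡ (q + q) + (q + q)
    quadruple = solve-∀
    double≤m : q + q ≤ m
    double≤m = ≤-trans (+-mono-≤ q≤half q≤half)
      (≤-trans (+-monoʳ-≤ ⌊ m /2⌋ (⌊n/2⌋≤⌈n/2⌉ m)) (≤-reflexive (⌊n/2⌋+⌈n/2⌉≡n m)))

decompose : ∀ m s → 1 ≤ m → s ≤ ⌊ (m ∸ 1) /2⌋ → ∃[ a′ ] (suc a′ + s + s ≡ m)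
decompose m s 1≤m s≤half = m ∸ suc (s + s) , (begin-equality
  suc (m ∸ suc (s + s)) + s + s   ≡⟨ +-assoc (suc (m ∸ suc (s + s))) s s ⟩
  suc (m ∸ suc (s + s)) + (s + s) ≡⟨ sym (+-suc (m ∸ suc (s + s)) (s + s)) ⟩
  m ∸ suc (s + s) + suc (s + s)   ≡⟨ m∸n+n≡m 2s<m ⟩
  m                               ∎)
  where
  open ≤-Reasoning
  2s<m : s + s < m
  2s<m = begin-strict
    s + s                          ≤⟨ +-mono-≤ s≤half s≤half ⟩
    ⌊ (m ∸ 1) /2⌋ + ⌊ (m ∸ 1) /2⌋  ≤⟨ +-monoʳ-≤ ⌊ (m ∸ 1) /2⌋ (⌊n/2⌋≤⌈n/2⌉ (m ∸ 1)) ⟩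
    ⌊ (m ∸ 1) /2⌋ + ⌈ (m ∸ 1) /2⌉  ≡⟨ ⌊n/2⌋+⌈n/2⌉≡n (m ∸ 1) ⟩
    m ∸ 1                          <⟨ ∸-monoʳ-< (s≤s z≤n) 1≤m ⟩
    m                              ∎

theorem2p5 : ∀ (m s : ℕ) → 3 ≤ m → 1 ≤ s → s ≤ ⌊ (m ∸ 1) /2⌋ →
    MinSeed≡ (P m s) 2 ⌈ (m + 1) /2⌉
theorem2p5 m s 3≤m 1≤s s≤half with decompose m s (≤-trans (s≤s z≤n) 3≤m) s≤half
... | a′ , refl = Construction.upper-bound a′ s 1≤s , lower
  where
  m′ = suc a′ + s + s
  s≤m : s ≤ m′
  s≤m = m≤n+m s (suc a′ + s)
  lower : ∀ S → Percolates (P m′ s) 2 S → ⌈ (m′ + 1) /2⌉ ≤ ∣ S ∣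
  lower S percolates = ceil-half-bound m′ ∣ S ∣
    (subcubic-lower-bound (P m′ s) (petersen-symmetric m′ s) (petersen-subcubic m′ s (s≤s z≤n) s≤m)
                          S (≤-trans (s≤s z≤n) (m≤m+n m′ m′)) percolates)
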